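{- Let $p_1,p_3,p_4$ be distinct primes and let $\hat K_1,\hat K_2,\hat K$ be as in the context. Then: (1) $\hat K_1\cap\hat K_2=\{0\}$ (the trivial group). (2) If $G\in\hat K_1$ and $H\leq_p G$, then $H\in\hat K_1$. (3) If $G\in\hat K_2$ with $G\neq 0$, $H\in\hat K$, and $G\leq_p H$, then $H\in\hat K_2$.
   Context: For an abelian group $G$ and prime $p$, $p^\omega G:=\bigcap_{n\geq 0}p^nG$. $H\leq_p G$ means $H$ is a pure subgroup: $nH=H\cap nG$ for all integers $n$. $\hat K_1$ is the class of torsion-free abelian groups $G$ with $G=p_1^\omega G$ and $p^\omega G=0$ for all primes $p\neq p_1$. $\hat K_2$ is the class of torsion-free abelian groups $G$ such that (a) for every $g\in p_1^\omega G$ there is at most one $z\in p_3^\omega G$ with $g+z\in p_4^\omega G$, and (b) for every $g\in p_1^\omega G$ there exist an integer $k>0$ and $z\in p_3^\omega G$ with $kg+z\in p_4^\omega G$. $\hat K=\hat K_1\cup\hat K_2$. -}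

module Defs where

open import Level using (Level; _⊔_)
open import Data.Nat using (ℕ; zero; suc; _^_; NonZero; _>_)
open import Data.Integer using (ℤ; +_; -[1+_])
open import Data.Nat.Primality using (Prime)
open import Data.Sum using (_⊎_)
open import Data.Product using (Σ; ∃; _×_; _,_)
open import Relation.Nullary using (¬_)
open import Relation.Binary.PropositionalEquality using (_≡_)
open import Algebra.Bundles using (AbelianGroup)

-- Generic notions for an abelian group G (written multiplicatively by the
-- stdlib record: _∙_ is the group operation, ε the zero, _⁻¹ the negation).
module _ {c ℓ : Level} (G : AbelianGroup c ℓ) where
  open AbelianGroup G

  infixr 8 _·ℕ_
  _·ℕ_ : ℕ → Carrier → Carrier
  zero  ·ℕ g = ε
  suc n ·ℕ g = g ∙ (n ·ℕ g)

  infixr 8 _·ℤ_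
  _·ℤ_ : ℤ → Carrier → Carrier
  (+ n)      ·ℤ g = n ·ℕ g
  (-[1+ n ]) ·ℤ g = (suc n ·ℕ g) ⁻¹

  InMultiple : ℤ → Carrier → Set (c ⊔ ℓ)
  InMultiple n g = Σ Carrier λ h → (n ·ℤ h) ≈ g

  InPω : ℕ → Carrier → Set (c ⊔ ℓ)
  InPω p g = (n : ℕ) → Σ Carrier λ h → ((p ^ n) ·ℕ h) ≈ g

  TorsionFree : Set (c ⊔ ℓ)
  TorsionFree = (n : ℕ) → n > 0 → (g : Carrier) → (n ·ℕ g) ≈ ε → g ≈ ε

  Trivial : Set (c ⊔ ℓ)
  Trivial = (g : Carrier) → g ≈ ε

  PωZero : ℕ → Set (c ⊔ ℓ)
  PωZero p = (g : Carrier) → InPω p g → g ≈ ε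

  InK̂₁ : ℕ → Set (c ⊔ ℓ)
  InK̂₁ p₁ =
    TorsionFree
    × ((g : Carrier) → InPω p₁ g)
    × ((p : ℕ) → Prime p → ¬ (p ≡ p₁) → PωZero p)

  InK̂₂ : ℕ → ℕ → ℕ → Set (c ⊔ ℓ)
  InK̂₂ p₁ p₃ p₄ =
    TorsionFree
    × ((g : Carrier) → InPω p₁ g →
         (z z′ : Carrier) → InPω p₃ z → InPω p₃ z′ →
         InPω p₄ (g ∙ z) → InPω p₄ (g ∙ z′) → z ≈ z′)
    × ((g : Carrier) → InPω p₁ g →
         Σ ℕ λ k → (k > 0) × (Σ Carrier λ z → InPω p₃ z × InPω p₄ ((k ·ℕ g) ∙ z)))

  InK̂ : ℕ → ℕ → ℕ → Set (c ⊔ ℓ)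
  InK̂ p₁ p₃ p₄ = InK̂₁ p₁ ⊎ InK̂₂ p₁ p₃ p₄

-- H ≤_p G, realised as a pure embedding of H into G: an injective group
-- homomorphism f : H → G such that nH = f⁻¹(nG) for every integer n
-- (the inclusion nH ⊆ f⁻¹(nG) holds automatically for homomorphisms).
record PureEmbedding {c₁ ℓ₁ c₂ ℓ₂ : Level}
         (H : AbelianGroup c₁ ℓ₁) (G : AbelianGroup c₂ ℓ₂)
         : Set (c₁ ⊔ ℓ₁ ⊔ c₂ ⊔ ℓ₂) where
  private
    module H = AbelianGroup H
    module G = AbelianGroup G
  field
    f      : H.Carrier → G.Carrier
    f-cong : ∀ {x y} → x H.≈ y → f x G.≈ f y
    f-hom  : ∀ x y → f (x H.∙ y) G.≈ (f x G.∙ f y)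
    f-inj  : ∀ {x y} → f x G.≈ f y → x H.≈ y
    pure   : (n : ℤ) (h : H.Carrier) → InMultiple G n (f h) → InMultiple H n h

{-# OPTIONS --safe #-}
-- A pure embedding f : H → G carries p^ω H into p^ω G, and purity gives the
-- converse, so K̂₁ is closed under pure subgroups. In a group of K̂₁ ∩ K̂₂,
-- condition (b) yields for every g some k > 0 and z ∈ p₃^ω G = 0 with
-- kg + z ∈ p₄^ω G = 0; hence kg = 0 and g = 0 by torsion-freeness. For (3), if
-- H lay in K̂₁ then so would its pure subgroup G, which would then be trivial.
module Submission where

open import Defs
open import Level using (Level)
open import Data.Nat using (ℕ; zero; suc; _^_; s≤s; z≤n)
open import Data.Nat.Primality using (Prime)
open import Data.Product using (_×_; _,_)
open import Data.Sum using (inj₁; inj₂)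
open import Data.Empty using (⊥-elim)
open import Data.Integer using (+_)
open import Relation.Nullary using (¬_)
open import Relation.Binary.PropositionalEquality using (_≡_; ≢-sym)
open import Function.Bundles using (_⇔_; mk⇔)
open import Algebra.Bundles using (AbelianGroup)
import Algebra.Properties.Group as GroupProperties
import Relation.Binary.Reasoning.Setoid as SetoidReasoning

module PureEmbeddingProperties {c₁ ℓ₁ c₂ ℓ₂ : Level}
  {H : AbelianGroup c₁ ℓ₁} {G : AbelianGroup c₂ ℓ₂} (e : PureEmbedding H G) where

  private
    module H = AbelianGroup H
    module G = AbelianGroup G
  open PureEmbedding e
  open SetoidReasoning G.setoid

  f-ε : f H.ε G.≈ G.ε
  f-ε = GroupProperties.identityˡ-unique G.group (f H.ε) (f H.ε) (begin
    f H.ε G.∙ f H.ε  ≈⟨ f-hom H.ε H.ε ⟨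
    f (H.ε H.∙ H.ε)  ≈⟨ f-cong (H.identityˡ H.ε) ⟩
    f H.ε            ∎)

  f-·ℕ : ∀ n h → f (_·ℕ_ H n h) G.≈ _·ℕ_ G n (f h)
  f-·ℕ zero    h = f-ε
  f-·ℕ (suc n) h = G.trans (f-hom h (_·ℕ_ H n h)) (G.∙-congˡ (f-·ℕ n h))

  f≈ε⇒≈ε : ∀ {h} → f h G.≈ G.ε → h H.≈ H.ε
  f≈ε⇒≈ε fh≈ε = f-inj (G.trans fh≈ε (G.sym f-ε))

  torsionFree-reflect : TorsionFree G → TorsionFree H
  torsionFree-reflect tfG n n>0 h nh≈ε = f≈ε⇒≈ε (tfG n n>0 (f h) (begin
    _·ℕ_ G n (f h)  ≈⟨ f-·ℕ n h ⟨
    f (_·ℕ_ H n h)  ≈⟨ f-cong nh≈ε ⟩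
    f H.ε           ≈⟨ f-ε ⟩
    G.ε             ∎))

  InPω-preserve : ∀ p {h} → InPω H p h → InPω G p (f h)
  InPω-preserve p hDiv n with hDiv n
  ... | h′ , pⁿh′≈h = f h′ , G.trans (G.sym (f-·ℕ (p ^ n) h′)) (f-cong pⁿh′≈h)

  InPω-reflect : ∀ p {h} → InPω G p (f h) → InPω H p h
  InPω-reflect p {h} fhDiv n = pure (+ (p ^ n)) h (fhDiv n)

  K̂₁-reflect : ∀ p₁ → InK̂₁ G p₁ → InK̂₁ H p₁
  K̂₁-reflect p₁ (tfG , p₁ωG , pωG≈0) =
      torsionFree-reflect tfG
    , (λ h → InPω-reflect p₁ (p₁ωG (f h)))
    , λ p prime p≢p₁ h hDiv → f≈ε⇒≈ε (pωG≈0 p prime p≢p₁ (f h) (InPω-preserve p hDiv))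

open PureEmbeddingProperties using (K̂₁-reflect)

module _ {c ℓ : Level} {G : AbelianGroup c ℓ} where
  open AbelianGroup G
  open SetoidReasoning setoid

  trivial⇒InPω : Trivial G → ∀ p g → InPω G p g
  trivial⇒InPω triv p g n = g , trans (triv _) (sym (triv g))

  trivial⇒K̂₁ : ∀ p₁ → Trivial G → InK̂₁ G p₁
  trivial⇒K̂₁ p₁ triv =
    (λ _ _ g _ → triv g) , trivial⇒InPω triv p₁ , λ _ _ _ g _ → triv g

  trivial⇒K̂₂ : ∀ p₁ p₃ p₄ → Trivial G → InK̂₂ G p₁ p₃ p₄
  trivial⇒K̂₂ p₁ p₃ p₄ triv =
      (λ _ _ g _ → triv g)
    , (λ _ _ z z′ _ _ _ _ → trans (triv z) (sym (triv z′)))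
    , λ g _ → 1 , s≤s z≤n , ε , trivial⇒InPω triv p₃ ε , trivial⇒InPω triv p₄ _

  K̂₁×K̂₂⇒trivial : ∀ {p₁ p₃ p₄} → Prime p₃ → Prime p₄ → ¬ (p₁ ≡ p₃) → ¬ (p₁ ≡ p₄) →
                  InK̂₁ G p₁ × InK̂₂ G p₁ p₃ p₄ → Trivial G
  K̂₁×K̂₂⇒trivial {_} {p₃} {p₄} prime₃ prime₄ p₁≢p₃ p₁≢p₄
                ((tf , p₁ωG , pωG≈0) , (_ , _ , b)) g with b g (p₁ωG g)
  ... | k , k>0 , z , zDiv , kg∙zDiv = tf k k>0 g (begin
    _·ℕ_ G k g      ≈⟨ identityʳ _ ⟨
    _·ℕ_ G k g ∙ ε  ≈⟨ ∙-congˡ (pωG≈0 p₃ prime₃ (≢-sym p₁≢p₃) z zDiv) ⟨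
    _·ℕ_ G k g ∙ z  ≈⟨ pωG≈0 p₄ prime₄ (≢-sym p₁≢p₄) _ kg∙zDiv ⟩
    ε               ∎)

proposition3p3 : {c₁ ℓ₁ c₂ ℓ₂ : Level} → (p₁ p₃ p₄ : ℕ) → Prime p₁ → Prime p₃ → Prime p₄ →
    ¬ (p₁ ≡ p₃) → ¬ (p₁ ≡ p₄) → ¬ (p₃ ≡ p₄) →
    -- (1) K̂₁ ∩ K̂₂ = {0}
    ((G : AbelianGroup c₁ ℓ₁) →
       (InK̂₁ G p₁ × InK̂₂ G p₁ p₃ p₄) ⇔ Trivial G)
    -- (2) K̂₁ is closed under pure subgroups
    × ((G : AbelianGroup c₂ ℓ₂) (H : AbelianGroup c₁ ℓ₁) →
       InK̂₁ G p₁ → PureEmbedding H G → InK̂₁ H p₁)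
    -- (3)
    × ((G : AbelianGroup c₁ ℓ₁) (H : AbelianGroup c₂ ℓ₂) →
       InK̂₂ G p₁ p₃ p₄ → ¬ Trivial G → InK̂ H p₁ p₃ p₄ →
       PureEmbedding G H → InK̂₂ H p₁ p₃ p₄)
proposition3p3 p₁ p₃ p₄ _ prime₃ prime₄ p₁≢p₃ p₁≢p₄ _ =
    (λ G → mk⇔ intersection⇒trivial λ triv →
        trivial⇒K̂₁ {G = G} p₁ triv , trivial⇒K̂₂ p₁ p₃ p₄ triv)
  , (λ _ _ G∈K̂₁ e → K̂₁-reflect e p₁ G∈K̂₁)
  , λ where
      _ _ _ _ (inj₂ H∈K̂₂) _ → H∈K̂₂
      _ _ G∈K̂₂ G≉0 (inj₁ H∈K̂₁) e →
        ⊥-elim (G≉0 (intersection⇒trivial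
          (K̂₁-reflect e p₁ H∈K̂₁ , G∈K̂₂)))
  where
    intersection⇒trivial : ∀ {c ℓ} {G : AbelianGroup c ℓ} →
                           InK̂₁ G p₁ × InK̂₂ G p₁ p₃ p₄ → Trivial G
    intersection⇒trivial = K̂₁×K̂₂⇒trivial prime₃ prime₄ p₁≢p₃ p₁≢p₄
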